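{- Let $\rho=(\rho_1,\rho_2,\ldots)$ be a sequence of positive integers, let $X_1,\ldots,X_k$ be indeterminates over $\mathbb{Z}$, and let $\delta=(\delta_1,\ldots,\delta_k,0,0,\ldots)\in E$ satisfy $s(\delta)=\rho_1+\cdots+\rho_\ell$ for some $\ell\geq 0$. Then $\mu_\rho(\delta)$ equals the coefficient of the monomial $X_1^{\delta_1}\cdots X_k^{\delta_k}$ in the expansion of \[ \prod_{m=1}^{\ell}\Bigl(\sum_{\substack{e_{m,1},\ldots,e_{m,k}\in\mathbb{N}_0\\ e_{m,1}+\cdots+e_{m,k}=\rho_m}}X_1^{e_{m,1}}\cdots X_k^{e_{m,k}}\Bigr). \]
   Context: $E$ is the set of finitely supported integer sequences $\delta=(\delta_1,\delta_2,\ldots)$ with componentwise addition, $s(\delta)=\sum_i\delta_i$, and $E_+\subset E$ the sequences with nonnegative entries. $E_\rho$ is the set of $\delta\in E$ with $s(\delta)\in\{0,\rho_1,\rho_1+\rho_2,\ldots\}$. The map $\mu_\rho:E\to\mathbb{N}_0$ is defined by: $\mu_\rho(0)=1$; $\mu_\rho(\delta)=0$ if some $\delta_i<0$; for $\delta\in E_\rho$ with $s(\delta)=\rho_1+\cdots+\rho_m$, $\mu_\rho(\delta)=\sum_{\gamma\in E_+,\ s(\gamma)=\rho_m}\mu_\rho(\delta-\gamma)$; and $\mu_\rho(\delta)=0$ for $\delta\notin E_\rho$. (A coefficient of a monomial with some negative exponent is understood to be $0$.) -}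

module Defs where

open import Data.Nat using (ℕ; zero; suc; _∸_; _≟_) renaming (_+_ to _+ℕ_)
open import Data.Integer using (ℤ; ∣_∣; +_; -[1+_]; _-_; _<?_) renaming (_+_ to _+ℤ_; _*_ to _*ℤ_)
open import Data.List using (List; []; _∷_; concatMap; upTo; filter; head; foldr; map)
open import Data.Vec using (Vec; []; _∷_; zipWith; replicate)
import Data.Vec as Vec
open import Data.Vec.Properties using (≡-dec)
open import Data.Vec.Relation.Unary.Any using (any?)
open import Data.Product using (_×_; _,_)
open import Data.Maybe using (just; nothing)
open import Relation.Nullary using (does; yes; no)
open import Data.Bool using (if_then_else_)
import Data.Integer.Properties as ℤP

-- ρ is 0-indexed: ρ 0 = ρ₁, ρ 1 = ρ₂, …
-- Partial sums P ρ m = ρ₁ + ⋯ + ρₘ.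
P : (ℕ → ℕ) → ℕ → ℕ
P ρ zero    = 0
P ρ (suc m) = P ρ m +ℕ ρ m

-- An element of E supported in the first k coordinates is a Vec ℤ k.
-- s(δ) = sum of the entries.
s : ∀ {k} → Vec ℤ k → ℤ
s = Vec.foldr _ _+ℤ_ (+ 0)

comps : ℕ → (k : ℕ) → List (Vec ℕ k)
comps zero    zero    = [] ∷ []
comps (suc n) zero    = []
comps n       (suc k) = concatMap (λ i → map (i ∷_) (comps (n ∸ i) k)) (upTo (suc n))

sumℕ : List ℕ → ℕ
sumℕ = foldr _+ℕ_ 0

_⊖_ : ∀ {k} → Vec ℤ k → Vec ℕ k → Vec ℤ k
δ ⊖ γ = zipWith _-_ δ (Vec.map +_ γ)

-- μ at "level" m, i.e. for δ with s(δ) = ρ₁ + ⋯ + ρₘ.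
-- level 0 : μ(0) = 1, otherwise (some entry negative) 0.
-- level m+1 : 0 if some entry is negative, otherwise
--   Σ_{γ ∈ E₊, s(γ) = ρ_{m+1}} μ(δ - γ)
-- (γ ranges over γ supported in the support of δ: any γ with a positive
--  entry outside it makes δ - γ have a negative entry, contributing 0).
μLevel : (ℕ → ℕ) → ∀ {k} → ℕ → Vec ℤ k → ℕ
μLevel ρ zero δ = if does (≡-dec ℤP._≟_ δ (replicate _ (+ 0))) then 1 else 0
μLevel ρ (suc m) δ =
  if does (any? (_<? + 0) δ) then 0
  else sumℕ (map (λ γ → μLevel ρ m (δ ⊖ γ)) (comps (ρ m) _))

-- μ_ρ(δ): if s(δ) = ρ₁ + ⋯ + ρₘ for some m, use level m; otherwise δ ∉ E_ρ and μ = 0.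
-- (For positive ρ, m is unique and m ≤ s(δ).)
μ : (ℕ → ℕ) → ∀ {k} → Vec ℤ k → ℕ
μ ρ δ with s δ
... | -[1+ _ ] = 0
... | + n with head (filter (λ m → P ρ m ≟ n) (upTo (suc n)))
...   | just m  = μLevel ρ m δ
...   | nothing = 0

-- Polynomials in X₁,…,X_k over ℤ as finite formal sums of terms
-- (coefficient, exponent vector).

Poly : ℕ → Set
Poly k = List (ℤ × Vec ℕ k)

monomial : ∀ {k} → Vec ℕ k → Poly k
monomial e = (+ 1 , e) ∷ []

1ₚ : ∀ {k} → Poly k
1ₚ = monomial (replicate _ 0)

_+ₚ_ : ∀ {k} → Poly k → Poly k → Poly k
p +ₚ q = Data.List._++_ p q

0ₚ : ∀ {k} → Poly k
0ₚ = []

_*ₚ_ : ∀ {k} → Poly k → Poly k → Poly k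
p *ₚ q = concatMap (λ { (a , e) → map (λ { (b , f) → (a *ℤ b , zipWith _+ℕ_ e f) }) q }) p

coeff : ∀ {k} → Poly k → Vec ℕ k → ℤ
coeff [] e = + 0
coeff ((a , f) ∷ p) e = if does (≡-dec _≟_ f e) then a +ℤ coeff p e else coeff p e

coeffℤ : ∀ {k} → Poly k → Vec ℤ k → ℤ
coeffℤ p δ = if does (any? (_<? + 0) δ) then + 0 else coeff p (Vec.map ∣_∣ δ)

homSum : (k : ℕ) → ℕ → Poly k
homSum k n = foldr (λ e p → monomial e +ₚ p) 0ₚ (comps n k)

theProduct : (ρ : ℕ → ℕ) (k ℓ : ℕ) → Poly k
theProduct ρ k zero    = 1ₚ
theProduct ρ k (suc ℓ) = theProduct ρ k ℓ *ₚ homSum k (ρ ℓ)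

-- Multiplying a polynomial by the complete homogeneous sum of degree ρ_{m+1} turns the
-- coefficient of X^δ into the sum, over exponent vectors γ of degree ρ_{m+1}, of the old
-- coefficients of X^(δ−γ), where negative exponents contribute 0. This is exactly the
-- recursion defining μ_ρ at level m+1, and both sides agree at level 0. Since the partial
-- sums of ρ are strictly increasing, s(δ) determines the level ℓ at which μ_ρ(δ) is computed.

module Submission where

open import Defs
open import Data.Nat using (ℕ; _<_)
open import Data.Integer using (ℤ; +_)
open import Data.Vec using (Vec)
open import Relation.Binary.PropositionalEquality using (_≡_)

open import Data.Nat as ℕ using (zero; suc; _≤_; z≤n; s≤s)
import Data.Nat.Properties as ℕP
open import Data.Integer as ℤ using (-[1+_]; ∣_∣; _-_; _<?_)
import Data.Integer.Properties as ℤP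
import Algebra.Bundles
open import Algebra.Properties.Group (Algebra.Bundles.AbelianGroup.group ℤP.+-0-abelianGroup) using (x≈z//y; //-rightDividesˡ)
open import Algebra.Properties.CommutativeSemigroup ℤP.+-commutativeSemigroup using (interchange)
open import Data.List as List using (List; []; _∷_; _++_; applyUpTo; upTo; filter; head)
open import Data.Vec as Vec using ([]; _∷_; zipWith; replicate)
open import Data.Vec.Properties using (≡-dec; ∷-injective; map-replicate)
open import Data.Vec.Relation.Unary.Any using (Any; here; there; any?)
open import Data.Bool using (true; false; if_then_else_)
open import Data.Bool.Properties using (if-float)
open import Data.Product using (_×_; _,_)
open import Data.Sum using (inj₁; inj₂)
open import Data.Maybe using (just)
open import Data.Empty using (⊥-elim)
open import Function.Bundles using (_⇔_; mk⇔; Equivalence)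
open import Relation.Nullary using (does; yes; no; ¬_)
open import Relation.Nullary.Decidable using (does-⇔; dec-false)
open import Relation.Unary using (Decidable)
open import Relation.Binary.Definitions using (DecidableEquality)
open import Relation.Binary.PropositionalEquality using (refl; sym; trans; cong; cong₂; subst; module ≡-Reasoning)
open ≡-Reasoning

HasNegative : ∀ {k} → Vec ℤ k → Set
HasNegative = Any (ℤ._< + 0)

x+y≡z⇔+z-+y≡+x : ∀ x y z → (x ℕ.+ y ≡ z) ⇔ (+ z - + y ≡ + x)
x+y≡z⇔+z-+y≡+x x y z = mk⇔ to from
  where
  to : x ℕ.+ y ≡ z → + z - + y ≡ + x
  to eq = sym (x≈z//y (+ x) (+ y) (+ z) (trans (sym (ℤP.pos-+ x y)) (cong +_ eq)))
  from : + z - + y ≡ + x → x ℕ.+ y ≡ z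
  from eq = ℤP.+-injective (begin
    + (x ℕ.+ y)       ≡⟨ ℤP.pos-+ x y ⟩
    + x ℤ.+ + y       ≡⟨ cong (ℤ._+ + y) eq ⟨
    + z - + y ℤ.+ + y ≡⟨ //-rightDividesˡ (+ y) (+ z) ⟩
    + z               ∎)

zipWith-+≡⇔map+-⊖≡map+ : ∀ {k} (e f g : Vec ℕ k) → (zipWith ℕ._+_ e f ≡ g) ⇔ (Vec.map +_ g ⊖ f ≡ Vec.map +_ e)
zipWith-+≡⇔map+-⊖≡map+ e f g = mk⇔ (to e f g) (from e f g)
  where
  to : ∀ {k} (e f g : Vec ℕ k) → zipWith ℕ._+_ e f ≡ g → Vec.map +_ g ⊖ f ≡ Vec.map +_ e
  to [] [] [] _ = refl
  to (x ∷ e) (y ∷ f) (z ∷ g) eq with ∷-injective eq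
  ... | eq₁ , eq₂ = cong₂ _∷_ (Equivalence.to (x+y≡z⇔+z-+y≡+x x y z) eq₁) (to e f g eq₂)
  from : ∀ {k} (e f g : Vec ℕ k) → Vec.map +_ g ⊖ f ≡ Vec.map +_ e → zipWith ℕ._+_ e f ≡ g
  from [] [] [] _ = refl
  from (x ∷ e) (y ∷ f) (z ∷ g) eq with ∷-injective eq
  ... | eq₁ , eq₂ = cong₂ _∷_ (Equivalence.from (x+y≡z⇔+z-+y≡+x x y z) eq₁) (from e f g eq₂)

¬HasNegative-map+ : ∀ {k} (e : Vec ℕ k) → ¬ HasNegative (Vec.map +_ e)
¬HasNegative-map+ (x ∷ e) (here (ℤ.+<+ ()))
¬HasNegative-map+ (x ∷ e) (there neg) = ¬HasNegative-map+ e neg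

map∣∣-map+ : ∀ {k} (e : Vec ℕ k) → Vec.map ∣_∣ (Vec.map +_ e) ≡ e
map∣∣-map+ [] = refl
map∣∣-map+ (x ∷ e) = cong (x ∷_) (map∣∣-map+ e)

map+-map∣∣ : ∀ {k} (δ : Vec ℤ k) → ¬ HasNegative δ → Vec.map +_ (Vec.map ∣_∣ δ) ≡ δ
map+-map∣∣ [] _ = refl
map+-map∣∣ (+ n ∷ δ) nonneg = cong (+ n ∷_) (map+-map∣∣ δ (λ neg → nonneg (there neg)))
map+-map∣∣ (-[1+ n ] ∷ δ) nonneg = ⊥-elim (nonneg (here ℤ.-<+))

≡map∣∣⇔map+≡ : ∀ {k} (e : Vec ℕ k) (δ : Vec ℤ k) → ¬ HasNegative δ → (e ≡ Vec.map ∣_∣ δ) ⇔ (δ ≡ Vec.map +_ e)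
≡map∣∣⇔map+≡ e δ nonneg = mk⇔
  (λ eq → trans (sym (map+-map∣∣ δ nonneg)) (cong (Vec.map +_) (sym eq)))
  (λ eq → trans (sym (map∣∣-map+ e)) (cong (Vec.map ∣_∣) (sym eq)))

_≟ᵥ_ : ∀ {k} → DecidableEquality (Vec ℤ k)
_≟ᵥ_ = ≡-dec ℤP._≟_

if-then-+ : ∀ b (a r : ℤ) → (if b then a ℤ.+ r else r) ≡ (if b then a else + 0) ℤ.+ r
if-then-+ true a r = refl
if-then-+ false a r = sym (ℤP.+-identityˡ r)

coeff-++ : ∀ {k} (p q : Poly k) e → coeff (p ++ q) e ≡ coeff p e ℤ.+ coeff q e
coeff-++ [] q e = sym (ℤP.+-identityˡ _)
coeff-++ ((a , f) ∷ p) q e with does (≡-dec ℕ._≟_ f e)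
... | true = trans (cong (λ r → a ℤ.+ r) (coeff-++ p q e)) (sym (ℤP.+-assoc a _ _))
... | false = coeff-++ p q e

coeffℤ-[] : ∀ {k} (δ : Vec ℤ k) → coeffℤ [] δ ≡ + 0
coeffℤ-[] δ with does (any? (_<? + 0) δ)
... | true = refl
... | false = refl

termCoeffℤ : ∀ {k} → ℤ × Vec ℕ k → Vec ℤ k → ℤ
termCoeffℤ (a , e) δ = if does (δ ≟ᵥ Vec.map +_ e) then a else + 0

coeffℤ-∷ : ∀ {k} (t : ℤ × Vec ℕ k) p (δ : Vec ℤ k) → coeffℤ (t ∷ p) δ ≡ termCoeffℤ t δ ℤ.+ coeffℤ p δ
coeffℤ-∷ {k} (a , e) p δ with any? (_<? + 0) δ
... | yes neg rewrite dec-false (δ ≟ᵥ Vec.map +_ e) (λ eq → ¬HasNegative-map+ e (subst HasNegative eq neg)) = refl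
... | no nonneg = begin
  (if does (≡-dec ℕ._≟_ e ∣δ∣) then a ℤ.+ coeff p ∣δ∣ else coeff p ∣δ∣)
    ≡⟨ if-then-+ (does (≡-dec ℕ._≟_ e ∣δ∣)) a (coeff p ∣δ∣) ⟩
  (if does (≡-dec ℕ._≟_ e ∣δ∣) then a else + 0) ℤ.+ coeff p ∣δ∣
    ≡⟨ cong (λ b → (if b then a else + 0) ℤ.+ coeff p ∣δ∣)
            (does-⇔ (≡map∣∣⇔map+≡ e δ nonneg) (≡-dec ℕ._≟_ e ∣δ∣) (δ ≟ᵥ Vec.map +_ e)) ⟩
  termCoeffℤ (a , e) δ ℤ.+ coeff p ∣δ∣ ∎
  where
  ∣δ∣ : Vec ℕ k
  ∣δ∣ = Vec.map ∣_∣ δ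

coeffℤ-[t] : ∀ {k} (t : ℤ × Vec ℕ k) (δ : Vec ℤ k) → coeffℤ (t ∷ []) δ ≡ termCoeffℤ t δ
coeffℤ-[t] t δ = begin
  coeffℤ (t ∷ []) δ              ≡⟨ coeffℤ-∷ t [] δ ⟩
  termCoeffℤ t δ ℤ.+ coeffℤ [] δ ≡⟨ cong (λ r → termCoeffℤ t δ ℤ.+ r) (coeffℤ-[] δ) ⟩
  termCoeffℤ t δ ℤ.+ + 0         ≡⟨ ℤP.+-identityʳ _ ⟩
  termCoeffℤ t δ                 ∎

∑ : ∀ {A : Set} → (A → ℤ) → List A → ℤ
∑ g [] = + 0
∑ g (x ∷ xs) = g x ℤ.+ ∑ g xs

∑-cong : ∀ {A : Set} {g h : A → ℤ} (xs : List A) → (∀ x → g x ≡ h x) → ∑ g xs ≡ ∑ h xs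
∑-cong [] g≗h = refl
∑-cong (x ∷ xs) g≗h = cong₂ ℤ._+_ (g≗h x) (∑-cong xs g≗h)

∑-+ : ∀ {A : Set} (g h : A → ℤ) (xs : List A) → ∑ g xs ℤ.+ ∑ h xs ≡ ∑ (λ x → g x ℤ.+ h x) xs
∑-+ g h [] = refl
∑-+ g h (x ∷ xs) = trans (interchange (g x) (∑ g xs) (h x) (∑ h xs)) (cong (λ r → g x ℤ.+ h x ℤ.+ r) (∑-+ g h xs))

∑-zero : ∀ {A : Set} {g : A → ℤ} (xs : List A) → (∀ x → g x ≡ + 0) → ∑ g xs ≡ + 0
∑-zero [] g≗0 = refl
∑-zero (x ∷ xs) g≗0 = cong₂ ℤ._+_ (g≗0 x) (∑-zero xs g≗0)

+-sumℕ-map : ∀ {A : Set} (f : A → ℕ) (xs : List A) → + sumℕ (List.map f xs) ≡ ∑ (λ x → + f x) xs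
+-sumℕ-map f [] = refl
+-sumℕ-map f (x ∷ xs) = trans (ℤP.pos-+ (f x) _) (cong (λ r → + f x ℤ.+ r) (+-sumℕ-map f xs))

sumMonomials : ∀ {k} → List (Vec ℕ k) → Poly k
sumMonomials = List.foldr (λ e p → monomial e +ₚ p) 0ₚ

mulTerm : ∀ {k} → ℤ × Vec ℕ k → Poly k → Poly k
mulTerm (a , e) = List.map (λ (b , f) → (a ℤ.* b , zipWith ℕ._+_ e f))

coeff-mulTerm-sumMonomials : ∀ {k} (t : ℤ × Vec ℕ k) fs g →
  coeff (mulTerm t (sumMonomials fs)) g ≡ ∑ (λ f → termCoeffℤ t (Vec.map +_ g ⊖ f)) fs
coeff-mulTerm-sumMonomials t [] g = refl
coeff-mulTerm-sumMonomials {k} (a , e) (f ∷ fs) g = begin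
  (if does (e+f ≟ₙ g) then a ℤ.* + 1 ℤ.+ rest else rest)
    ≡⟨ cong (λ c → if does (e+f ≟ₙ g) then c ℤ.+ rest else rest) (ℤP.*-identityʳ a) ⟩
  (if does (e+f ≟ₙ g) then a ℤ.+ rest else rest)
    ≡⟨ if-then-+ (does (e+f ≟ₙ g)) a rest ⟩
  (if does (e+f ≟ₙ g) then a else + 0) ℤ.+ rest
    ≡⟨ cong₂ (λ b r → (if b then a else + 0) ℤ.+ r)
             (does-⇔ (zipWith-+≡⇔map+-⊖≡map+ e f g) (e+f ≟ₙ g) ((Vec.map +_ g ⊖ f) ≟ᵥ Vec.map +_ e))
             (coeff-mulTerm-sumMonomials (a , e) fs g) ⟩
  ∑ (λ f → termCoeffℤ (a , e) (Vec.map +_ g ⊖ f)) (f ∷ fs) ∎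
  where
  _≟ₙ_ : DecidableEquality (Vec ℕ k)
  _≟ₙ_ = ≡-dec ℕ._≟_
  e+f : Vec ℕ k
  e+f = zipWith ℕ._+_ e f
  rest : ℤ
  rest = coeff (mulTerm (a , e) (sumMonomials fs)) g

coeff-*ₚ-sumMonomials : ∀ {k} (p : Poly k) fs g → coeff (p *ₚ sumMonomials fs) g ≡ ∑ (λ f → coeffℤ p (Vec.map +_ g ⊖ f)) fs
coeff-*ₚ-sumMonomials [] fs g = sym (∑-zero fs (λ f → coeffℤ-[] (Vec.map +_ g ⊖ f)))
coeff-*ₚ-sumMonomials (t ∷ p) fs g = begin
  coeff ((t ∷ p) *ₚ sumMonomials fs) g
    ≡⟨ coeff-++ (mulTerm t (sumMonomials fs)) (p *ₚ sumMonomials fs) g ⟩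
  coeff (mulTerm t (sumMonomials fs)) g ℤ.+ coeff (p *ₚ sumMonomials fs) g
    ≡⟨ cong₂ ℤ._+_ (coeff-mulTerm-sumMonomials t fs g) (coeff-*ₚ-sumMonomials p fs g) ⟩
  ∑ (λ f → termCoeffℤ t (Vec.map +_ g ⊖ f)) fs ℤ.+ ∑ (λ f → coeffℤ p (Vec.map +_ g ⊖ f)) fs
    ≡⟨ ∑-+ _ _ fs ⟩
  ∑ (λ f → termCoeffℤ t (Vec.map +_ g ⊖ f) ℤ.+ coeffℤ p (Vec.map +_ g ⊖ f)) fs
    ≡⟨ ∑-cong fs (λ f → sym (coeffℤ-∷ t p (Vec.map +_ g ⊖ f))) ⟩
  ∑ (λ f → coeffℤ (t ∷ p) (Vec.map +_ g ⊖ f)) fs ∎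

μLevel≡coeffℤ-theProduct : ∀ ρ k m (δ : Vec ℤ k) → + μLevel ρ m δ ≡ coeffℤ (theProduct ρ k m) δ
μLevel≡coeffℤ-theProduct ρ k zero δ = begin
  + (if does (δ ≟ᵥ replicate k (+ 0)) then 1 else 0)
    ≡⟨ if-float +_ (does (δ ≟ᵥ replicate k (+ 0))) ⟩
  (if does (δ ≟ᵥ replicate k (+ 0)) then + 1 else + 0)
    ≡⟨ cong (λ z → if does (δ ≟ᵥ z) then + 1 else + 0) (map-replicate +_ 0 k) ⟨
  termCoeffℤ (+ 1 , replicate k 0) δ
    ≡⟨ coeffℤ-[t] (+ 1 , replicate k 0) δ ⟨
  coeffℤ 1ₚ δ ∎
μLevel≡coeffℤ-theProduct ρ k (suc m) δ with any? (_<? + 0) δ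
... | yes _ = refl
... | no nonneg = begin
  + sumℕ (List.map (λ γ → μLevel ρ m (δ ⊖ γ)) (comps (ρ m) k))
    ≡⟨ +-sumℕ-map (λ γ → μLevel ρ m (δ ⊖ γ)) (comps (ρ m) k) ⟩
  ∑ (λ γ → + μLevel ρ m (δ ⊖ γ)) (comps (ρ m) k)
    ≡⟨ ∑-cong (comps (ρ m) k) (λ γ → μLevel≡coeffℤ-theProduct ρ k m (δ ⊖ γ)) ⟩
  ∑ (λ γ → coeffℤ (theProduct ρ k m) (δ ⊖ γ)) (comps (ρ m) k)
    ≡⟨ cong (λ δ′ → ∑ (λ γ → coeffℤ (theProduct ρ k m) (δ′ ⊖ γ)) (comps (ρ m) k)) (map+-map∣∣ δ nonneg) ⟨
  ∑ (λ γ → coeffℤ (theProduct ρ k m) (Vec.map +_ (Vec.map ∣_∣ δ) ⊖ γ)) (comps (ρ m) k)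
    -- homSum k (ρ m) is sumMonomials (comps (ρ m) k) by definition
    ≡⟨ coeff-*ₚ-sumMonomials (theProduct ρ k m) (comps (ρ m) k) (Vec.map ∣_∣ δ) ⟨
  coeff (theProduct ρ k (suc m)) (Vec.map ∣_∣ δ) ∎

head-filter-applyUpTo : ∀ {A : Set} {Q : A → Set} (Q? : Decidable Q) (f : ℕ → A) {ℓ n} → ℓ < n → Q (f ℓ) →
  (∀ m → m < ℓ → ¬ Q (f m)) → head (filter Q? (applyUpTo f n)) ≡ just (f ℓ)
head-filter-applyUpTo Q? f {zero} {suc n} _ Qfℓ _ with Q? (f 0)
... | yes _ = refl
... | no ¬Qf0 = ⊥-elim (¬Qf0 Qfℓ)
head-filter-applyUpTo Q? f {suc ℓ} {suc n} (s≤s ℓ<n) Qfℓ earlier with Q? (f 0)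
... | yes Qf0 = ⊥-elim (earlier 0 (s≤s z≤n) Qf0)
... | no _ = head-filter-applyUpTo Q? (λ m → f (suc m)) ℓ<n Qfℓ (λ m m<ℓ → earlier (suc m) (s≤s m<ℓ))

module _ (ρ : ℕ → ℕ) (ρ-positive : ∀ i → 0 < ρ i) where

  P-strictlyMonotone : ∀ {m n} → m < n → P ρ m < P ρ n
  P-strictlyMonotone {m} {suc n} (s≤s m≤n) with ℕP.m≤n⇒m<n∨m≡n m≤n
  ... | inj₁ m<n = ℕP.<-≤-trans (P-strictlyMonotone m<n) (ℕP.m≤m+n (P ρ n) (ρ n))
  ... | inj₂ refl = ℕP.m<m+n (P ρ m) (ρ-positive m)

  ≤P : ∀ n → n ≤ P ρ n
  ≤P zero = z≤n
  ≤P (suc n) = subst (_≤ P ρ n ℕ.+ ρ n) (ℕP.+-comm n 1) (ℕP.+-mono-≤ (≤P n) (ρ-positive n))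

  μ≡μLevel : ∀ {k} (δ : Vec ℤ k) ℓ → s δ ≡ + P ρ ℓ → μ ρ δ ≡ μLevel ρ ℓ δ
  μ≡μLevel δ ℓ sδ≡Pℓ with s δ | sδ≡Pℓ
  ... | + .(P ρ ℓ) | refl
    with head (filter (λ m → P ρ m ℕ.≟ P ρ ℓ) (upTo (suc (P ρ ℓ))))
       | head-filter-applyUpTo (λ m → P ρ m ℕ.≟ P ρ ℓ) (λ m → m) (s≤s (≤P ℓ)) refl
           (λ m m<ℓ Pm≡Pℓ → ℕP.<-irrefl Pm≡Pℓ (P-strictlyMonotone m<ℓ))
  ... | just .ℓ | refl = refl

mainTheorem2 : (ρ : ℕ → ℕ) → (∀ i → 0 < ρ i) →
    (k : ℕ) (δ : Vec ℤ k) (ℓ : ℕ) → s δ ≡ + P ρ ℓ →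
    + μ ρ δ ≡ coeffℤ (theProduct ρ k ℓ) δ
mainTheorem2 ρ ρ-positive k δ ℓ sδ≡Pℓ = begin
  + μ ρ δ                        ≡⟨ cong +_ (μ≡μLevel ρ ρ-positive δ ℓ sδ≡Pℓ) ⟩
  + μLevel ρ ℓ δ                 ≡⟨ μLevel≡coeffℤ-theProduct ρ k ℓ δ ⟩
  coeffℤ (theProduct ρ k ℓ) δ    ∎
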